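{- Let $p$ be an odd prime and $(s_{p,i})_{i\ge0}$ the pseudo-$p$-Singer sequence. For every positive integer $k$ and every $0\le i\le \frac{p^k-1}{2}$, one has $s_{p,i}=s_{p,\frac{p^k-1}{2}-i}$.
   Context: $p_2=(p-1)/2$; $\binom{a}{b}$ is the usual binomial coefficient for nonnegative integers $a\ge b$ and $0$ otherwise. Let $\varphi_p$ be the substitution on $\{0,1,\dots,p-1\}$ (identified with $\mathbb{F}_p$) sending each letter $n$ to the length-$p$ word whose $i$-th letter ($0\le i\le p-1$) is $n\binom{p_2}{i}\bmod p$, extended to words by concatenation. The pseudo-$p$-Singer sequence is $(s_{p,i})_{i\ge0}=\lim_{k\to\infty}\varphi_p^k(1)$. -}

module Defs where

open import Data.Nat using (ℕ; zero; suc; _+_; _*_; _∸_; _^_; NonZero)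
open import Data.Nat.DivMod using (_%_; _/_)
open import Data.Nat.Combinatorics using (_C_)
open import Data.List using (List; []; _∷_; concatMap; map; upTo; lookup; length)
open import Data.Maybe using (Maybe; just; nothing; fromMaybe)

half : ℕ → ℕ
half p = (p ∸ 1) / 2

-- image of the letter n under φ_p : the word  (n * binom(p₂, i) mod p)_{0 ≤ i ≤ p-1}
-- (Data.Nat.Combinatorics._C_ is 0 when i > p₂, as in the paper's convention)
φ-letter : (p : ℕ) → .{{NonZero p}} → ℕ → List ℕ
φ-letter p n = map (λ i → (n * (half p C i)) % p) (upTo p)

φ : (p : ℕ) → .{{NonZero p}} → List ℕ → List ℕ
φ p w = concatMap (φ-letter p) w

φ^ : (p : ℕ) → .{{NonZero p}} → ℕ → List ℕ → List ℕ
φ^ p zero    w = w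
φ^ p (suc k) w = φ p (φ^ p k w)

_!!_ : List ℕ → ℕ → Maybe ℕ
[] !! _ = nothing
(x ∷ xs) !! zero = just x
(x ∷ xs) !! suc i = xs !! i

-- The pseudo-p-Singer sequence s_{p,i} = lim_k φ_p^k(1) at index i.
-- Since φ_p(1) begins with 1, φ_p^k(1) is a prefix of φ_p^{k+1}(1) and has
-- length p^k > i once k = i + 1 (p ≥ 2); so the limit's i-th letter is the
-- i-th letter of φ_p^{i+1}(1).  (The default 0 is never used for p ≥ 2.)
singer : (p : ℕ) → .{{NonZero p}} → ℕ → ℕ
singer p i = fromMaybe 0 (φ^ p (suc i) (1 ∷ []) !! i)

-- Write p = 2h + 1.  The substitution gives the digit recurrence
-- s (r + n p) = s n · C(h, r) mod p for r < p, and the centre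
-- (p^k − 1)/2 has base-p digits h h … h.  If i + j equals that centre,
-- adding the last digits of i and j gives either exactly h without carry,
-- where C(h, r) = C(h, h − r) and induction on k applies to the remaining
-- digits, or h + p with a carry, where both digits exceed h and both
-- letters vanish.
module Submission where

open import Defs
open import Data.Nat using (ℕ; zero; suc; _+_; _*_; _∸_; _^_; _≤_; _<_; _≤′_; ≤′-refl; ≤′-step; NonZero; nonTrivial⇒n>1; z≤n; s≤s; z<s)
open import Data.Nat.Properties
open import Algebra.Properties.CommutativeSemigroup +-commutativeSemigroup using (x∙yz≈y∙xz; x∙yz≈yx∙z)
open import Data.Nat.DivMod using (_/_; _%_; m≡m%n+[m/n]*n; m%n<n; m*n/n≡m; m/n≤m; m<n⇒m%n≡m; [m+kn]%n≡m%n)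
open import Data.Nat.Divisibility using (_∣_; m%n≡0⇒n∣m)
open import Data.Nat.Primality using (Prime; prime⇒irreducible; prime⇒nonTrivial)
open import Data.Nat.Combinatorics using (_C_; k>n⇒nCk≡0; nCk≡nC[n∸k])
open import Data.Nat.Tactic.RingSolver using (solve-∀)
open import Data.List using (List; []; _∷_; _++_; length; map; applyUpTo; upTo; concatMap)
open import Data.List.Properties using (length-++; length-map; length-upTo; concatMap-++; ++-assoc; ++-identityʳ)
open import Data.Maybe using (just; fromMaybe; _>>=_)
import Data.Maybe as Maybe
open import Function using (id)
open import Data.Product using (∃; _×_; _,_)
open import Data.Sum using (_⊎_; inj₁; inj₂)
open import Relation.Binary.PropositionalEquality
open import Relation.Nullary using (¬_; yes; no; contradiction)

!!-++ˡ : ∀ xs ys {i} → i < length xs → (xs ++ ys) !! i ≡ xs !! i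
!!-++ˡ (x ∷ xs) ys {zero}  _         = refl
!!-++ˡ (x ∷ xs) ys {suc i} (s≤s i<n) = !!-++ˡ xs ys i<n

!!-++ʳ : ∀ xs ys j → (xs ++ ys) !! (length xs + j) ≡ ys !! j
!!-++ʳ []       ys j = refl
!!-++ʳ (x ∷ xs) ys j = !!-++ʳ xs ys j

!!-map : ∀ (f : ℕ → ℕ) xs {i} → map f xs !! i ≡ Maybe.map f (xs !! i)
!!-map f []                = refl
!!-map f (x ∷ xs) {zero}  = refl
!!-map f (x ∷ xs) {suc i} = !!-map f xs

!!-applyUpTo : ∀ f {n i} → i < n → applyUpTo f n !! i ≡ just (f i)
!!-applyUpTo f {suc n} {zero}  _         = refl
!!-applyUpTo f {suc n} {suc i} (s≤s i<n) = !!-applyUpTo (λ k → f (suc k)) i<n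

!!≡just⇒<length : ∀ xs {i x} → xs !! i ≡ just x → i < length xs
!!≡just⇒<length (y ∷ ys) {zero}  _  = s≤s z≤n
!!≡just⇒<length (y ∷ ys) {suc i} eq = s≤s (!!≡just⇒<length ys eq)

<length⇒!!≡just : ∀ xs {i} d → i < length xs → xs !! i ≡ just (fromMaybe d (xs !! i))
<length⇒!!≡just (x ∷ xs) {zero}  d _         = refl
<length⇒!!≡just (x ∷ xs) {suc i} d (s≤s i<n) = <length⇒!!≡just xs d i<n

!!0≡just⇒≡∷ : ∀ xs {x} → xs !! 0 ≡ just x → ∃ λ ys → xs ≡ x ∷ ys
!!0≡just⇒≡∷ (y ∷ ys) refl = ys , refl

module _ {p} (g : ℕ → List ℕ) (length-g : ∀ a → length (g a) ≡ p) where

  length-concatMap : ∀ w → length (concatMap g w) ≡ length w * p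
  length-concatMap []      = refl
  length-concatMap (a ∷ w) =
    trans (length-++ (g a)) (cong₂ _+_ (length-g a) (length-concatMap w))

  !!-concatMap : ∀ w {r} n → r < p → concatMap g w !! (r + n * p) ≡ (w !! n >>= λ a → g a !! r)
  !!-concatMap []      n       r<p = refl
  !!-concatMap (a ∷ w) {r} zero r<p = begin
    (g a ++ concatMap g w) !! (r + 0) ≡⟨ cong ((g a ++ concatMap g w) !!_) (+-identityʳ r) ⟩
    (g a ++ concatMap g w) !! r       ≡⟨ !!-++ˡ (g a) _ (subst (r <_) (sym (length-g a)) r<p) ⟩
    g a !! r                          ∎
    where open ≡-Reasoning
  !!-concatMap (a ∷ w) {r} (suc n) r<p = begin
    (g a ++ concatMap g w) !! (r + (p + n * p))            ≡⟨ cong ((g a ++ concatMap g w) !!_) (x∙yz≈y∙xz r p (n * p)) ⟩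
    (g a ++ concatMap g w) !! (p + (r + n * p))            ≡⟨ cong (λ l → (g a ++ concatMap g w) !! (l + (r + n * p))) (sym (length-g a)) ⟩
    (g a ++ concatMap g w) !! (length (g a) + (r + n * p)) ≡⟨ !!-++ʳ (g a) _ _ ⟩
    concatMap g w !! (r + n * p)                           ≡⟨ !!-concatMap w n r<p ⟩
    (w !! n >>= λ a → g a !! r)                            ∎
    where open ≡-Reasoning

half<n : ∀ n .{{_ : NonZero n}} → half n < n
half<n (suc n) = s≤s (m/n≤m n 2)

k+m≡n⇒nCk≡nCm : ∀ {k m n} → k + m ≡ n → n C k ≡ n C m
k+m≡n⇒nCk≡nCm {k} {m} refl = trans (nCk≡nC[n∸k] (m≤m+n k m)) (cong ((k + m) C_) (m+n∸m≡n k m))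

m+n≡[m%d+n%d]+[m/d+n/d]*d : ∀ m n d .{{_ : NonZero d}} → m + n ≡ (m % d + n % d) + (m / d + n / d) * d
m+n≡[m%d+n%d]+[m/d+n/d]*d m n d = begin
  m + n                                         ≡⟨ cong₂ _+_ (m≡m%n+[m/n]*n m d) (m≡m%n+[m/n]*n n d) ⟩
  (m % d + m / d * d) + (n % d + n / d * d)     ≡⟨ regroup (m % d) (n % d) (m / d) (n / d) d ⟩
  (m % d + n % d) + (m / d + n / d) * d         ∎
  where
  open ≡-Reasoning
  regroup : ∀ a b c e d → (a + c * d) + (b + e * d) ≡ (a + b) + (c + e) * d
  regroup = solve-∀

divMod-unique : ∀ {n a b s t} .{{_ : NonZero n}} → a < n → b < n → a + s * n ≡ b + t * n → a ≡ b × s ≡ t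
divMod-unique {n} {a} {b} {s} {t} a<n b<n eq =
  a≡b , *-cancelʳ-≡ s t n (+-cancelˡ-≡ a _ _ (trans eq (cong (_+ t * n) (sym a≡b))))
  where
  open ≡-Reasoning
  a≡b : a ≡ b
  a≡b = begin
    a               ≡⟨ m<n⇒m%n≡m a<n ⟨
    a % n           ≡⟨ [m+kn]%n≡m%n a s n ⟨
    (a + s * n) % n ≡⟨ cong (_% n) eq ⟩
    (b + t * n) % n ≡⟨ [m+kn]%n≡m%n b t n ⟩
    b % n           ≡⟨ m<n⇒m%n≡m b<n ⟩
    b               ∎

digit-sum-carry : ∀ {n a h s t} .{{_ : NonZero n}} → a < n + n → h < n → a + s * n ≡ h + t * n →
                  (a ≡ h × s ≡ t) ⊎ (a ≡ n + h × suc s ≡ t)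
digit-sum-carry {n} {a} {h} {s} {t} a<2n h<n eq with a <? n
... | yes a<n = inj₁ (divMod-unique a<n h<n eq)
... | no a≮n with a ∸ n | m+[n∸m]≡n (≮⇒≥ a≮n)
...   | c | refl with divMod-unique (+-cancelˡ-< n c n a<2n) h<n (trans (x∙yz≈yx∙z c n (s * n)) eq)
...     | c≡h , 1+s≡t = inj₂ (cong (n +_) c≡h , 1+s≡t)

carry⇒< : ∀ {n h a b} → a + b ≡ n + h → b < n → h < a
carry⇒< {n} {h} {a} {b} a+b≡n+h b<n = +-cancelʳ-< n h a (begin-strict
  h + n ≡⟨ +-comm h n ⟩
  n + h ≡⟨ a+b≡n+h ⟨
  a + b <⟨ +-monoʳ-< a b<n ⟩
  a + n ∎)
  where open ≤-Reasoning

module SingerRecurrence (p : ℕ) .{{_ : NonZero p}} (2≤p : 2 ≤ p) where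

  length-φ-letter : ∀ a → length (φ-letter p a) ≡ p
  length-φ-letter a = trans (length-map _ (upTo p)) (length-upTo p)

  φ-letter-!! : ∀ a {r} → r < p → φ-letter p a !! r ≡ just ((a * (half p C r)) % p)
  φ-letter-!! a r<p = trans (!!-map _ (upTo p)) (cong (Maybe.map _) (!!-applyUpTo id r<p))

  length-φ : ∀ w → length (φ p w) ≡ length w * p
  length-φ = length-concatMap (φ-letter p) length-φ-letter

  φ-!! : ∀ w {r} n → r < p → φ p w !! (r + n * p) ≡ (w !! n >>= λ a → φ-letter p a !! r)
  φ-!! = !!-concatMap (φ-letter p) length-φ-letter

  word : ℕ → List ℕ
  word k = φ^ p k (1 ∷ [])

  word-1-!!0 : word 1 !! 0 ≡ just 1
  word-1-!!0 = begin
    φ p (1 ∷ []) !! 0 ≡⟨ φ-!! (1 ∷ []) 0 0<p ⟩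
    φ-letter p 1 !! 0 ≡⟨ φ-letter-!! 1 0<p ⟩
    just (1 % p)      ≡⟨ cong just (m<n⇒m%n≡m 2≤p) ⟩
    just 1            ∎
    where
    open ≡-Reasoning
    0<p = <-trans z<s 2≤p

  word-suc-prefix : ∀ k → ∃ λ ys → word (suc k) ≡ word k ++ ys
  word-suc-prefix zero    = !!0≡just⇒≡∷ (word 1) word-1-!!0
  word-suc-prefix (suc k) with word-suc-prefix k
  ... | ys , eq = φ p ys , trans (cong (φ p) eq) (concatMap-++ (φ-letter p) (word k) ys)

  word-prefix : ∀ {m n} → m ≤′ n → ∃ λ ys → word n ≡ word m ++ ys
  word-prefix {m} ≤′-refl = [] , sym (++-identityʳ (word m))
  word-prefix {m} (≤′-step {n} m≤′n) with word-prefix m≤′n | word-suc-prefix n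
  ... | ys , eq | zs , eq′ = ys ++ zs , (begin
    word (suc n)        ≡⟨ eq′ ⟩
    word n ++ zs        ≡⟨ cong (_++ zs) eq ⟩
    (word m ++ ys) ++ zs ≡⟨ ++-assoc (word m) ys zs ⟩
    word m ++ ys ++ zs  ∎)
    where open ≡-Reasoning

  k<length-word : ∀ k → k < length (word k)
  k<length-word zero    = s≤s z≤n
  k<length-word (suc k) = begin-strict
    suc k     <⟨ s≤s (k<length-word k) ⟩
    suc L     ≤⟨ +-monoˡ-≤ L (≤-trans (s≤s z≤n) (k<length-word k)) ⟩
    L + L     ≡⟨ cong (L +_) (+-identityʳ L) ⟨
    2 * L     ≤⟨ *-monoˡ-≤ L 2≤p ⟩
    p * L     ≡⟨ *-comm p L ⟩
    L * p     ≡⟨ length-φ (word k) ⟨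
    length (word (suc k)) ∎
    where
    open ≤-Reasoning
    L = length (word k)

  word-!!-stable : ∀ {m n i} → m ≤ n → i < length (word m) → word n !! i ≡ word m !! i
  word-!!-stable {m} m≤n i<L with word-prefix (≤⇒≤′ m≤n)
  ... | ys , eq = trans (cong (_!! _) eq) (!!-++ˡ (word m) ys i<L)

  word-!!⇒singer : ∀ k {i x} → word k !! i ≡ just x → singer p i ≡ x
  word-!!⇒singer k {i} eq with ≤-total k (suc i)
  ... | inj₁ k≤1+i = cong (fromMaybe 0) (trans (word-!!-stable k≤1+i (!!≡just⇒<length (word k) eq)) eq)
  ... | inj₂ 1+i≤k = cong (fromMaybe 0) (trans (sym (word-!!-stable 1+i≤k (<-trans (n<1+n i) (k<length-word (suc i))))) eq)

  singer-digit : ∀ n {r} → r < p → singer p (r + n * p) ≡ (singer p n * (half p C r)) % p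
  singer-digit n {r} r<p = word-!!⇒singer (suc (suc n)) (begin
    φ p (word (suc n)) !! (r + n * p)               ≡⟨ φ-!! (word (suc n)) n r<p ⟩
    (word (suc n) !! n >>= λ a → φ-letter p a !! r) ≡⟨ cong (_>>= λ a → φ-letter p a !! r) word-!!-singer ⟩
    φ-letter p (singer p n) !! r                    ≡⟨ φ-letter-!! (singer p n) r<p ⟩
    just ((singer p n * (half p C r)) % p)          ∎)
    where
    open ≡-Reasoning
    word-!!-singer : word (suc n) !! n ≡ just (singer p n)
    word-!!-singer = <length⇒!!≡just (word (suc n)) 0 (<-trans (n<1+n n) (k<length-word (suc n)))

  singer-digits : ∀ i → singer p i ≡ (singer p (i / p) * (half p C (i % p))) % p
  singer-digits i = trans (cong (singer p) (m≡m%n+[m/n]*n i p)) (singer-digit (i / p) (m%n<n i p))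

module Palindrome (p : ℕ) .{{_ : NonZero p}} (2≤p : 2 ≤ p) where
  open SingerRecurrence p 2≤p using (singer-digits)

  mid : ℕ → ℕ
  mid zero    = 0
  mid (suc k) = half p + mid k * p

  [p^k∸1]/2≡mid : p ≡ 1 + half p * 2 → ∀ k → (p ^ k ∸ 1) / 2 ≡ mid k
  [p^k∸1]/2≡mid p-odd k = trans (cong (λ x → (x ∸ 1) / 2) (p^k≡1+mid*2 k)) (m*n/n≡m (mid k) 2)
    where
    odd-step : ∀ h m → (1 + h * 2) * (1 + m * 2) ≡ 1 + (h + m * (1 + h * 2)) * 2
    odd-step = solve-∀
    p^k≡1+mid*2 : ∀ k → p ^ k ≡ 1 + mid k * 2
    p^k≡1+mid*2 zero    = refl
    p^k≡1+mid*2 (suc k) = trans (cong (p *_) (p^k≡1+mid*2 k))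
      (subst (λ q → q * (1 + mid k * 2) ≡ 1 + (half p + mid k * q) * 2) (sym p-odd) (odd-step (half p) (mid k)))

  letter-vanishes : ∀ s {r} → half p < r → (s * (half p C r)) % p ≡ 0 % p
  letter-vanishes s h<r = trans (cong (λ c → (s * c) % p) (k>n⇒nCk≡0 h<r)) (cong (_% p) (*-zeroʳ s))

  singer-palindrome : ∀ k i j → i + j ≡ mid k → singer p i ≡ singer p j
  singer-palindrome zero    zero    _ refl = refl
  singer-palindrome zero    (suc i) _ ()
  singer-palindrome (suc k) i j i+j≡mid
    with digit-sum-carry {a = i % p + j % p} {s = i / p + j / p} (+-mono-< (m%n<n i p) (m%n<n j p)) (half<n p)
           (trans (sym (m+n≡[m%d+n%d]+[m/d+n/d]*d i j p)) i+j≡mid)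
  ... | inj₁ (r+r′≡h , n+n′≡mid) = begin
    singer p i                                  ≡⟨ singer-digits i ⟩
    (singer p (i / p) * (half p C (i % p))) % p ≡⟨ cong₂ (λ s c → (s * c) % p)
                                                     (singer-palindrome k (i / p) (j / p) n+n′≡mid) (k+m≡n⇒nCk≡nCm {i % p} r+r′≡h) ⟩
    (singer p (j / p) * (half p C (j % p))) % p ≡⟨ singer-digits j ⟨
    singer p j                                  ∎
    where open ≡-Reasoning
  ... | inj₂ (r+r′≡p+h , _) = begin
    singer p i                                  ≡⟨ singer-digits i ⟩
    (singer p (i / p) * (half p C (i % p))) % p ≡⟨ letter-vanishes (singer p (i / p)) (carry⇒< {a = i % p} r+r′≡p+h (m%n<n j p)) ⟩
    0 % p                                       ≡⟨ letter-vanishes (singer p (j / p)) (carry⇒< {a = j % p} (trans (+-comm (j % p) (i % p)) r+r′≡p+h) (m%n<n i p)) ⟨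
    (singer p (j / p) * (half p C (j % p))) % p ≡⟨ singer-digits j ⟨
    singer p j                                  ∎
    where open ≡-Reasoning

¬2∣n⇒n≡1+half*2 : ∀ {n} → ¬ 2 ∣ n → n ≡ 1 + half n * 2
¬2∣n⇒n≡1+half*2 {n} 2∤n = trans n≡1+[n/2]*2 (cong (λ m → 1 + m * 2) (sym half≡n/2))
  where
  n%2≡1 : n % 2 ≡ 1
  n%2≡1 with n % 2 in eq | m%n<n n 2
  ... | 0           | _               = contradiction (m%n≡0⇒n∣m n 2 eq) 2∤n
  ... | 1           | _               = refl
  ... | suc (suc _) | s≤s (s≤s ())
  n≡1+[n/2]*2 : n ≡ 1 + n / 2 * 2
  n≡1+[n/2]*2 = trans (m≡m%n+[m/n]*n n 2) (cong (_+ n / 2 * 2) n%2≡1)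
  half≡n/2 : half n ≡ n / 2
  half≡n/2 = trans (cong (λ m → (m ∸ 1) / 2) n≡1+[n/2]*2) (m*n/n≡m (n / 2) 2)

odd-prime⇒¬2∣ : ∀ {p} → Prime p → p ≢ 2 → ¬ 2 ∣ p
odd-prime⇒¬2∣ pr p≢2 2∣p with prime⇒irreducible pr 2∣p
... | inj₁ ()
... | inj₂ 2≡p = p≢2 (sym 2≡p)

lemma3p9 : (p : ℕ) → .{{_ : NonZero p}} → Prime p → ¬ (p ≡ 2) → (k : ℕ) → 1 ≤ k → (i : ℕ) → i ≤ (p ^ k ∸ 1) / 2 → singer p i ≡ singer p ((p ^ k ∸ 1) / 2 ∸ i)
lemma3p9 p pr p≢2 k _ i i≤c = singer-palindrome k i _ (trans (m+[n∸m]≡n i≤c) ([p^k∸1]/2≡mid p-odd k))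
  where
  open Palindrome p (nonTrivial⇒n>1 p {{prime⇒nonTrivial pr}})
  p-odd : p ≡ 1 + half p * 2
  p-odd = ¬2∣n⇒n≡1+half*2 (odd-prime⇒¬2∣ pr p≢2)
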